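{- Let $G$ be a finite group, $H$ a normal subgroup and $K$ a subgroup of $G$, with either $H\cap K=\{1\}$ or $K\subseteq H$. Let $N=[G:K]$, $I=[G:HK]$, $J=[HK:K]$. Let $\{s_1,\dots,s_I\}$ be a transversal for the left cosets of $HK$ in $G$ and $\{t_1,\dots,t_J\}$ a transversal for the left cosets of $K$ in $HK$. Define $\lambda:G\to\mathbb{Z}$ by $\lambda(g)=J-1$ if $g\in K$, $\lambda(g)=-1$ if $g\in HK\setminus K$, and $\lambda(g)=0$ if $g\notin HK$. For each $i=1,\dots,I$ let $\mathcal{J}_i\subseteq\{1,\dots,J\}$ have cardinality $J-1$. Then the collection of $N-I$ functions $\{[s_it_j,\lambda]: i=1,\dots,I,\ j\in\mathcal{J}_i\}\subseteq\mathcal{L}$ is linearly independent. Moreover, for each $i$, the $J-1$ functions $[s_it_j,\lambda]$, $j\in\mathcal{J}_i$, are supported on the left coset $s_iHK$.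
   Context: $HK$ is a subgroup of $G$. $\mathbb{Z}^N$ denotes the free abelian group of functions $f:G\to\mathbb{Z}$ constant on each left coset of $K$; $G$ acts on it by $[g,f](x)=f(g^{ -1}x)$. $\mathcal{L}=\{f\in\mathbb{Z}^N: \sum_{j=1}^J f(s_it_j)=0 \text{ for each } i=1,\dots,I\}$, equivalently the $f$ whose sum over each left coset of $HK$ is zero; it has rank $N-I$ and contains $\lambda$. -}

module Defs where

open import Data.Nat using (ℕ; zero; suc)
open import Data.Fin using (Fin; zero; suc)
open import Data.Fin.Properties using (any?) renaming (_≟_ to _≟F_)
open import Data.Bool using (Bool; true; false)
open import Data.Bool.Properties using () renaming (_≟_ to _≟B_)
open import Data.Integer using (ℤ; +_; _-_; _+_; 0ℤ; 1ℤ; -1ℤ)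
open import Data.Product using (Σ; ∃; ∃₂; _×_; _,_)
open import Relation.Nullary using (Dec; yes; no)
open import Relation.Nullary.Decidable using (_×-dec_)
open import Relation.Binary.PropositionalEquality using (_≡_)
open import Algebra.Structures using (IsGroup)

-- A finite group, presented (up to isomorphism) on the carrier Fin order.
record FinGroup : Set where
  field
    order   : ℕ
    _∙_     : Fin order → Fin order → Fin order
    ε       : Fin order
    _⁻¹     : Fin order → Fin order
    isGroup : IsGroup _≡_ _∙_ ε _⁻¹
  infixl 7 _∙_
  infix 8 _⁻¹
  Carrier : Set
  Carrier = Fin order

sumℤ : ∀ {m} → (Fin m → ℤ) → ℤ
sumℤ {zero}  f = 0ℤ
sumℤ {suc m} f = f zero + sumℤ (λ i → f (suc i))

module _ (G : FinGroup) where
  open FinGroup G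

  record Subgroup : Set where
    field
      mem      : Carrier → Bool
      ε∈       : mem ε ≡ true
      ∙-closed : ∀ x y → mem x ≡ true → mem y ≡ true → mem (x ∙ y) ≡ true
      ⁻¹-closed : ∀ x → mem x ≡ true → mem (x ⁻¹) ≡ true

  open Subgroup public

  IsNormal : Subgroup → Set
  IsNormal H = ∀ g h → mem H h ≡ true → mem H ((g ∙ h) ∙ g ⁻¹) ≡ true

  InHK : Subgroup → Subgroup → Carrier → Set
  InHK H K g = ∃₂ λ h k → mem H h ≡ true × mem K k ≡ true × g ≡ h ∙ k

  HK? : (H K : Subgroup) (g : Carrier) → Dec (InHK H K g)
  HK? H K g = any? λ h → any? λ k →
    (mem H h ≟B true) ×-dec ((mem K k ≟B true) ×-dec (g ≟F (h ∙ k)))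

  IsLeftTransversalHK : (H K : Subgroup) {I : ℕ} → (Fin I → Carrier) → Set
  IsLeftTransversalHK H K {I} s =
    (∀ g → Σ (Fin I) λ i → InHK H K (s i ⁻¹ ∙ g)) ×
    (∀ i i′ → InHK H K (s i ⁻¹ ∙ s i′) → i ≡ i′)

  IsLeftTransversalK-in-HK : (H K : Subgroup) {J : ℕ} → (Fin J → Carrier) → Set
  IsLeftTransversalK-in-HK H K {J} t =
    (∀ j → InHK H K (t j)) ×
    (∀ x → InHK H K x → Σ (Fin J) λ j → mem K (t j ⁻¹ ∙ x) ≡ true) ×
    (∀ j j′ → mem K (t j ⁻¹ ∙ t j′) ≡ true → j ≡ j′)

  lam : (H K : Subgroup) (J : ℕ) → Carrier → ℤ
  lam H K J g with mem K g | HK? H K g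
  ... | true  | _     = + J - 1ℤ
  ... | false | yes _ = -1ℤ
  ... | false | no _  = 0ℤ

  -- the action [g,f](x) = f(g⁻¹ x)
  act : Carrier → (Carrier → ℤ) → Carrier → ℤ
  act g f x = f (g ⁻¹ ∙ x)

  -- f ∈ ℤ^N : constant on each left coset xK
  InZN : Subgroup → (Carrier → ℤ) → Set
  InZN K f = ∀ x k → mem K k ≡ true → f (x ∙ k) ≡ f x

  -- f ∈ 𝓛 : f ∈ ℤ^N and Σ_j f(s_i t_j) = 0 for every i
  InL : (K : Subgroup) {I J : ℕ} → (Fin I → Carrier) → (Fin J → Carrier) → (Carrier → ℤ) → Set
  InL K s t f = InZN K f × (∀ i → sumℤ (λ j → f (s i ∙ t j)) ≡ 0ℤ)

-- Evaluating [s_i t_j, λ] at s_i' t_j' gives 0 unless i = i', and otherwise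
-- λ(t_j⁻¹ t_j'), which is J - 1 for j = j' and -1 for j ≠ j'. So each diagonal block
-- of the evaluation matrix is J·Id - 𝟙 with 𝟙 the all-ones matrix. Its column sums
-- vanish, which puts the functions in 𝓛, and its kernel consists of the constant
-- vectors: a vanishing combination has coefficients constant along each row i, and
-- that constant is the coefficient of the index missing from 𝒥_i, namely 0.
module Submission where

open import Defs
open import Data.Nat as ℕ using (ℕ; suc; _∸_; _<_)
open import Data.Nat.Properties using (<⇒≱; n<1+n)
open import Data.Fin using (Fin; zero; suc)
open import Data.Fin.Properties using (suc-injective; ¬∀⟶∃¬; nonZeroIndex) renaming (_≟_ to _≟F_)
open import Data.Fin.Subset using (Subset; _∈_; _∉_; ∣_∣; ⊤)
open import Data.Fin.Subset.Properties using (_∈?_; ∣⊤∣≡n; p⊆q⇒∣p∣≤∣q∣)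
open import Data.Integer using (ℤ; +_; _+_; _-_; _*_; 0ℤ; 1ℤ; -1ℤ)
open import Data.Integer.Properties using (+-identityˡ; +-identityʳ; *-zeroʳ; *-identityˡ; *-cancelʳ-≡; i-j≡0⇒i≡j)
open import Data.Integer.Tactic.RingSolver using (solve-∀)
open import Data.Bool using (true; false)
open import Data.Bool.Properties using (¬-not)
open import Data.Product using (_×_; _,_; ∃; proj₁; proj₂)
open import Data.Sum using (_⊎_)
open import Relation.Nullary using (¬_; Dec; yes; no; contradiction)
open import Relation.Binary.PropositionalEquality
  using (_≡_; _≢_; refl; sym; trans; cong; cong₂; subst; module ≡-Reasoning)
open import Algebra.Structures using (IsGroup)
open import Algebra.Bundles using (Group)
import Algebra.Properties.Group as GroupProperties

sumℤ-cong : ∀ {n} {f g : Fin n → ℤ} → (∀ k → f k ≡ g k) → sumℤ f ≡ sumℤ g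
sumℤ-cong {ℕ.zero} f≗g = refl
sumℤ-cong {suc n}  f≗g = cong₂ _+_ (f≗g zero) (sumℤ-cong (λ k → f≗g (suc k)))

sumℤ-zero : ∀ {n} {f : Fin n → ℤ} → (∀ k → f k ≡ 0ℤ) → sumℤ f ≡ 0ℤ
sumℤ-zero {ℕ.zero} f≗0 = refl
sumℤ-zero {suc n}  f≗0 = cong₂ _+_ (f≗0 zero) (sumℤ-zero (λ k → f≗0 (suc k)))

sumℤ-ones : ∀ n → sumℤ {n} (λ _ → 1ℤ) ≡ + n
sumℤ-ones ℕ.zero  = refl
sumℤ-ones (suc n) = cong (λ z → 1ℤ + z) (sumℤ-ones n)

sumℤ-*ʳ : ∀ {n} (c : Fin n → ℤ) b → sumℤ (λ k → c k * b) ≡ b * sumℤ c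
sumℤ-*ʳ {ℕ.zero} c b = sym (*-zeroʳ b)
sumℤ-*ʳ {suc n}  c b =
  trans (cong (λ z → c zero * b + z) (sumℤ-*ʳ (λ k → c (suc k)) b)) (distrib (c zero) b _)
  where
  distrib : ∀ x b y → x * b + b * y ≡ b * (x + y)
  distrib = solve-∀

sumℤ-single : ∀ {n} (f : Fin n → ℤ) a → (∀ k → k ≢ a → f k ≡ 0ℤ) → sumℤ f ≡ f a
sumℤ-single {suc n} f zero    f≗0 =
  trans (cong (λ z → f zero + z) (sumℤ-zero (λ k → f≗0 (suc k) λ ()))) (+-identityʳ (f zero))
sumℤ-single {suc n} f (suc a) f≗0 =
  trans (cong₂ _+_ (f≗0 zero λ ())
                   (sumℤ-single (λ k → f (suc k)) a (λ k k≢a → f≗0 (suc k) (λ eq → k≢a (suc-injective eq)))))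
        (+-identityˡ (f (suc a)))

sumℤ-*-spike : ∀ {n} (c v : Fin n → ℤ) m b → (∀ k → k ≢ m → v k ≡ b) →
               sumℤ (λ k → c k * v k) ≡ c m * (v m - b) + b * sumℤ c
sumℤ-*-spike {suc n} c v zero b v≗b =
  trans (cong (λ z → c zero * v zero + z)
              (trans (sumℤ-cong (λ k → cong (c (suc k) *_) (v≗b (suc k) λ ())))
                     (sumℤ-*ʳ (λ k → c (suc k)) b)))
        (regroup (c zero) (v zero) b _)
  where
  regroup : ∀ x v b y → x * v + b * y ≡ x * (v - b) + b * (x + y)
  regroup = solve-∀
sumℤ-*-spike {suc n} c v (suc m) b v≗b =
  trans (cong₂ _+_ (cong (c zero *_) (v≗b zero λ ()))
                   (sumℤ-*-spike (λ k → c (suc k)) (λ k → v (suc k)) m b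
                                 (λ k k≢m → v≗b (suc k) (λ eq → k≢m (suc-injective eq)))))
        (regroup (c zero) b (c (suc m) * (v (suc m) - b)) _)
  where
  regroup : ∀ x b z y → x * b + (z + b * y) ≡ z + b * (x + y)
  regroup = solve-∀

∣p∣<n⇒∃∉ : ∀ {n} (p : Subset n) → ∣ p ∣ < n → ∃ (_∉ p)
∣p∣<n⇒∃∉ {n} p ∣p∣<n = ¬∀⟶∃¬ n (_∈ p) (_∈? p) λ all∈p →
  <⇒≱ ∣p∣<n (subst (ℕ._≤ ∣ p ∣) (∣⊤∣≡n n) (p⊆q⇒∣p∣≤∣q∣ {p = ⊤} (λ {x} _ → all∈p x)))

n∸1<n : ∀ {n} → Fin n → n ∸ 1 < n
n∸1<n {suc n} _ = n<1+n n

module GroupFacts (G : FinGroup) where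
  open FinGroup G public
  open IsGroup isGroup public using (assoc; identityˡ; inverseˡ)

  group : Group _ _
  group = record { isGroup = isGroup }

  open GroupProperties group public
    using (⁻¹-anti-homo-∙; \\-leftDividesʳ; //-rightDividesˡ; //-rightDividesʳ)

  act-∙ : ∀ a b (f : Carrier → ℤ) x → act G (a ∙ b) f x ≡ act G a (act G b f) x
  act-∙ a b f x = cong f (trans (cong (_∙ x) (⁻¹-anti-homo-∙ a b)) (assoc (b ⁻¹) (a ⁻¹) x))

  act-InZN : ∀ K g {f} → InZN G K f → InZN G K (act G g f)
  act-InZN K g {f} f∈ℤᴺ x k k∈K =
    trans (cong f (sym (assoc (g ⁻¹) x k))) (f∈ℤᴺ (g ⁻¹ ∙ x) k k∈K)

  mem-cancelʳ : ∀ (K : Subgroup G) {x k} → mem K k ≡ true → mem K (x ∙ k) ≡ true → mem K x ≡ true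
  mem-cancelʳ K {x} {k} k∈K xk∈K =
    subst (λ y → mem K y ≡ true) (//-rightDividesʳ k x) (∙-closed K _ _ xk∈K (⁻¹-closed K k k∈K))

module ProductSet (G : FinGroup) (H K : Subgroup G) (H-normal : IsNormal G H) where
  open GroupFacts G
  open ≡-Reasoning

  HK : Carrier → Set
  HK = InHK G H K

  K⊆HK : ∀ {k} → mem K k ≡ true → HK k
  K⊆HK {k} k∈K = ε , k , ε∈ H , k∈K , sym (identityˡ k)

  -- h k · h′ k′ = (h · k h′ k⁻¹) · k k′
  HK-∙ : ∀ {x y} → HK x → HK y → HK (x ∙ y)
  HK-∙ (h , k , h∈H , k∈K , refl) (h′ , k′ , h′∈H , k′∈K , refl) =
    h ∙ ((k ∙ h′) ∙ k ⁻¹) , k ∙ k′ ,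
    ∙-closed H h _ h∈H (H-normal k h′ h′∈H) , ∙-closed K k k′ k∈K k′∈K , sym regroup
    where
    regroup : (h ∙ ((k ∙ h′) ∙ k ⁻¹)) ∙ (k ∙ k′) ≡ (h ∙ k) ∙ (h′ ∙ k′)
    regroup = begin
      (h ∙ ((k ∙ h′) ∙ k ⁻¹)) ∙ (k ∙ k′) ≡⟨ assoc h _ _ ⟩
      h ∙ (((k ∙ h′) ∙ k ⁻¹) ∙ (k ∙ k′)) ≡⟨ cong (h ∙_) (assoc (k ∙ h′) _ _) ⟩
      h ∙ ((k ∙ h′) ∙ (k ⁻¹ ∙ (k ∙ k′))) ≡⟨ cong (λ z → h ∙ ((k ∙ h′) ∙ z)) (\\-leftDividesʳ k k′) ⟩
      h ∙ ((k ∙ h′) ∙ k′)                ≡⟨ cong (h ∙_) (assoc k h′ k′) ⟩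
      h ∙ (k ∙ (h′ ∙ k′))                ≡⟨ assoc h k _ ⟨
      (h ∙ k) ∙ (h′ ∙ k′)                ∎

  -- (h k)⁻¹ = (k⁻¹ h⁻¹ k) · k⁻¹
  HK-⁻¹ : ∀ {x} → HK x → HK (x ⁻¹)
  HK-⁻¹ (h , k , h∈H , k∈K , refl) =
    (k ⁻¹ ∙ h ⁻¹) ∙ k ⁻¹ ⁻¹ , k ⁻¹ ,
    H-normal (k ⁻¹) (h ⁻¹) (⁻¹-closed H h h∈H) , ⁻¹-closed K k k∈K ,
    trans (⁻¹-anti-homo-∙ h k) (sym (//-rightDividesˡ (k ⁻¹) (k ⁻¹ ∙ h ⁻¹)))

  HK-cancelˡ : ∀ {a x} → HK a → HK (a ∙ x) → HK x
  HK-cancelˡ {a} {x} a∈HK ax∈HK = subst HK (\\-leftDividesʳ a x) (HK-∙ (HK-⁻¹ a∈HK) ax∈HK)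

  HK-cancelʳ : ∀ {b x} → HK b → HK (x ∙ b) → HK x
  HK-cancelʳ {b} {x} b∈HK xb∈HK = subst HK (//-rightDividesʳ b x) (HK-∙ xb∈HK (HK-⁻¹ b∈HK))

  module Weight (J : ℕ) where
    Λ : Carrier → ℤ
    Λ = lam G H K J

    Λ-K : ∀ {g} → mem K g ≡ true → Λ g ≡ + J - 1ℤ
    Λ-K {g} g∈K with mem K g | HK? G H K g
    ... | true  | _ = refl
    ... | false | _ = contradiction g∈K λ ()

    Λ-HK∖K : ∀ {g} → mem K g ≡ false → HK g → Λ g ≡ -1ℤ
    Λ-HK∖K {g} g∉K g∈HK with mem K g | HK? G H K g
    ... | true  | _         = contradiction g∉K λ ()
    ... | false | yes _     = refl
    ... | false | no  g∉HK = contradiction g∈HK g∉HK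

    Λ-outside : ∀ {g} → ¬ HK g → Λ g ≡ 0ℤ
    Λ-outside {g} g∉HK with mem K g in g∈K | HK? G H K g
    ... | true  | _         = contradiction (K⊆HK g∈K) g∉HK
    ... | false | yes g∈HK = contradiction g∈HK g∉HK
    ... | false | no  _     = refl

    Λ-InZN : InZN G K Λ
    Λ-InZN x k k∈K = by-cases (mem K x) refl (HK? G H K x)
      where
      by-cases : ∀ b → mem K x ≡ b → Dec (HK x) → Λ (x ∙ k) ≡ Λ x
      by-cases true x∈K _ = trans (Λ-K (∙-closed K x k x∈K k∈K)) (sym (Λ-K x∈K))
      by-cases false x∉K (yes x∈HK) =
        trans (Λ-HK∖K xk∉K (HK-∙ x∈HK (K⊆HK k∈K))) (sym (Λ-HK∖K x∉K x∈HK))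
        where
        xk∉K : mem K (x ∙ k) ≡ false
        xk∉K = ¬-not λ xk∈K → contradiction (trans (sym x∉K) (mem-cancelʳ K k∈K xk∈K)) λ ()
      by-cases false _ (no x∉HK) =
        trans (Λ-outside λ xk∈HK → x∉HK (HK-cancelʳ (K⊆HK k∈K) xk∈HK)) (sym (Λ-outside x∉HK))

    act-Λ-outside : ∀ {g y} → HK g → ¬ HK y → act G g Λ y ≡ 0ℤ
    act-Λ-outside g∈HK y∉HK = Λ-outside λ g⁻¹y∈HK → y∉HK (HK-cancelˡ (HK-⁻¹ g∈HK) g⁻¹y∈HK)

  module Translates (I J : ℕ) (s : Fin I → Carrier) (t : Fin J → Carrier)
                    (s-transversal : IsLeftTransversalHK G H K s)
                    (t-transversal : IsLeftTransversalK-in-HK G H K t) where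
    open Weight J

    φ : Fin I → Fin J → Carrier → ℤ
    φ i j = act G (s i ∙ t j) Λ

    t∈HK : ∀ j → HK (t j)
    t∈HK = proj₁ t-transversal

    φ-supported : ∀ i j x → ¬ HK (s i ⁻¹ ∙ x) → φ i j x ≡ 0ℤ
    φ-supported i j x x∉sᵢHK = trans (act-∙ (s i) (t j) Λ x) (act-Λ-outside (t∈HK j) x∉sᵢHK)

    φ-offBlock : ∀ {i i′} → i ≢ i′ → ∀ j j′ → φ i j (s i′ ∙ t j′) ≡ 0ℤ
    φ-offBlock {i} {i′} i≢i′ j j′ = φ-supported i j _ λ x∈sᵢHK →
      i≢i′ (proj₂ s-transversal i i′ (HK-cancelʳ (t∈HK j′) (subst HK (sym (assoc _ _ _)) x∈sᵢHK)))

    φ-block : ∀ i j j′ → φ i j (s i ∙ t j′) ≡ Λ (t j ⁻¹ ∙ t j′)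
    φ-block i j j′ = trans (act-∙ (s i) (t j) Λ _) (cong (act G (t j) Λ) (\\-leftDividesʳ (s i) (t j′)))

    φ-diag : ∀ i j → φ i j (s i ∙ t j) ≡ + J - 1ℤ
    φ-diag i j = trans (φ-block i j j) (Λ-K (subst (λ g → mem K g ≡ true) (sym (inverseˡ (t j))) (ε∈ K)))

    φ-offDiag : ∀ i {j j′} → j ≢ j′ → φ i j (s i ∙ t j′) ≡ -1ℤ
    φ-offDiag i {j} {j′} j≢j′ =
      trans (φ-block i j j′) (Λ-HK∖K tⱼ⁻¹tⱼ′∉K (HK-∙ (HK-⁻¹ (t∈HK j)) (t∈HK j′)))
      where
      tⱼ⁻¹tⱼ′∉K : mem K (t j ⁻¹ ∙ t j′) ≡ false
      tⱼ⁻¹tⱼ′∉K = ¬-not λ tⱼ⁻¹tⱼ′∈K → j≢j′ (proj₂ (proj₂ t-transversal) j j′ tⱼ⁻¹tⱼ′∈K)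

    φ-columnSum : ∀ i j i′ → sumℤ (λ j′ → φ i j (s i′ ∙ t j′)) ≡ 0ℤ
    φ-columnSum i j i′ with i ≟F i′
    ... | no i≢i′ = sumℤ-zero (φ-offBlock i≢i′ j)
    ... | yes refl = begin
      sumℤ (λ j′ → φ i j (s i ∙ t j′))        ≡⟨ sumℤ-cong (λ j′ → sym (*-identityˡ (φ i j (s i ∙ t j′)))) ⟩
      sumℤ (λ j′ → 1ℤ * φ i j (s i ∙ t j′))   ≡⟨ sumℤ-*-spike (λ _ → 1ℤ) (λ j′ → φ i j (s i ∙ t j′)) j -1ℤ
                                                   (λ j′ j′≢j → φ-offDiag i (λ eq → j′≢j (sym eq))) ⟩
      1ℤ * (φ i j (s i ∙ t j) - -1ℤ) + -1ℤ * sumℤ {J} (λ _ → 1ℤ)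
        ≡⟨ cong₂ (λ a b → 1ℤ * (a - -1ℤ) + -1ℤ * b) (φ-diag i j) (sumℤ-ones J) ⟩
      1ℤ * ((+ J - 1ℤ) - -1ℤ) + -1ℤ * + J   ≡⟨ cancel (+ J) ⟩
      0ℤ                                      ∎
      where
      cancel : ∀ n → 1ℤ * ((n - 1ℤ) - -1ℤ) + -1ℤ * n ≡ 0ℤ
      cancel = solve-∀

    φ-InL : ∀ i j → InL G K s t (φ i j)
    φ-InL i j = act-InZN K (s i ∙ t j) Λ-InZN , φ-columnSum i j

    combination-at : ∀ (c : Fin I → Fin J → ℤ) i m →
      sumℤ (λ i′ → sumℤ (λ j → c i′ j * φ i′ j (s i ∙ t m))) ≡ c i m * + J - sumℤ (c i)
    combination-at c i m = begin
      sumℤ (λ i′ → sumℤ (λ j → c i′ j * φ i′ j (s i ∙ t m)))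
        ≡⟨ sumℤ-single _ i (λ i′ i′≢i → sumℤ-zero λ j →
             trans (cong (c i′ j *_) (φ-offBlock i′≢i j m)) (*-zeroʳ (c i′ j))) ⟩
      sumℤ (λ j → c i j * φ i j (s i ∙ t m))
        ≡⟨ sumℤ-*-spike (c i) (λ j → φ i j (s i ∙ t m)) m -1ℤ (λ j j≢m → φ-offDiag i j≢m) ⟩
      c i m * (φ i m (s i ∙ t m) - -1ℤ) + -1ℤ * sumℤ (c i)
        ≡⟨ cong (λ a → c i m * (a - -1ℤ) + -1ℤ * sumℤ (c i)) (φ-diag i m) ⟩
      c i m * ((+ J - 1ℤ) - -1ℤ) + -1ℤ * sumℤ (c i)
        ≡⟨ simplify (c i m) (+ J) (sumℤ (c i)) ⟩
      c i m * + J - sumℤ (c i) ∎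
      where
      simplify : ∀ c n S → c * ((n - 1ℤ) - -1ℤ) + -1ℤ * S ≡ c * n - S
      simplify = solve-∀

    vanishing-combination-rowConstant : ∀ (c : Fin I → Fin J → ℤ) →
      (∀ x → sumℤ (λ i → sumℤ (λ j → c i j * φ i j x)) ≡ 0ℤ) →
      ∀ i m m′ → c i m ≡ c i m′
    vanishing-combination-rowConstant c vanishes i m m′ =
      *-cancelʳ-≡ (c i m) (c i m′) (+ J) {{nonZeroIndex m}} (trans (row-sum m) (sym (row-sum m′)))
      where
      row-sum : ∀ m → c i m * + J ≡ sumℤ (c i)
      row-sum m = i-j≡0⇒i≡j _ _ (trans (sym (combination-at c i m)) (vanishes (s i ∙ t m)))

lemma3p3 : (G : FinGroup) → let open FinGroup G in
    (H K : Subgroup G) → IsNormal G H →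
    ((∀ g → mem H g ≡ true → mem K g ≡ true → g ≡ ε) ⊎ (∀ g → mem K g ≡ true → mem H g ≡ true)) →
    (I J : ℕ) (s : Fin I → Carrier) (t : Fin J → Carrier) →
    IsLeftTransversalHK G H K s → IsLeftTransversalK-in-HK G H K t →
    (𝒥 : Fin I → Subset J) → (∀ i → ∣ 𝒥 i ∣ ≡ J ∸ 1) →
    -- each [s_i t_j, λ] lies in 𝓛
    (∀ i j → j ∈ 𝒥 i → InL G K s t (act G (s i ∙ t j) (lam G H K J))) ×
    -- linear independence of the family {[s_i t_j, λ] : i, j ∈ 𝒥_i}
    (∀ (c : Fin I → Fin J → ℤ) → (∀ i j → ¬ j ∈ 𝒥 i → c i j ≡ 0ℤ) →
      (∀ x → sumℤ (λ i → sumℤ (λ j → c i j * act G (s i ∙ t j) (lam G H K J) x)) ≡ 0ℤ) →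
      ∀ i j → j ∈ 𝒥 i → c i j ≡ 0ℤ) ×
    -- support on the coset s_i HK
    (∀ i j → j ∈ 𝒥 i → ∀ x → ¬ InHK G H K (s i ⁻¹ ∙ x) → act G (s i ∙ t j) (lam G H K J) x ≡ 0ℤ)
lemma3p3 G H K H-normal _ I J s t s-transversal t-transversal 𝒥 ∣𝒥∣≡J∸1 =
  (λ i j _ → φ-InL i j) ,
  (λ c c≡0-off-𝒥 vanishes i j _ →
    let m , m∉𝒥ᵢ = missing i j in
    trans (vanishing-combination-rowConstant c vanishes i j m) (c≡0-off-𝒥 i m m∉𝒥ᵢ)) ,
  (λ i j _ → φ-supported i j)
  where
  open ProductSet G H K H-normal
  open Translates I J s t s-transversal t-transversal

  missing : ∀ i → Fin J → ∃ (_∉ 𝒥 i)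
  missing i j = ∣p∣<n⇒∃∉ (𝒥 i) (subst (_< J) (sym (∣𝒥∣≡J∸1 i)) (n∸1<n j))
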